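{- Let $L$ be a mathematically agreeable language and let $\mathcal L$, $D$, $G$, $F$ be as in the context. Let $U\subseteq D$ be consistent with $U=G(U)$. Then for every sentence $A$ of $\mathcal L$ with $\#A\in G(U)\cup F(U)$, we have $\#[A\leftrightarrow T(\lceil A\rceil)]\in G(U)$ (i.e. $A\leftrightarrow T(\lceil A\rceil)$ is true) and $\#[A\leftrightarrow \neg T(\lceil A\rceil)]\in F(U)$ (i.e. $A\leftrightarrow\neg T(\lceil A\rceil)$ is false).
   Context: A language $L$ is mathematically agreeable (MA) if: it contains a countable syntax of first-order predicate logic with equality, with natural numbers and their names (numerals) as terms; it is fully interpreted, i.e. each sentence of $L$ is interpreted either as true or as false (not both); classical truth tables hold for $\neg,\vee,\wedge,\rightarrow,\leftrightarrow$ and classical truth rules hold for $\forall,\exists$. Let $T$ be a monadic predicate whose domain of discourse is the set of numerals. Let $\mathcal L$ be the language whose basic sentences are the sentences of $L$, the sentences $T(\mathbf n)$ for numerals $\mathbf n$, $\forall xT(x)$ and $\exists xT(x)$, and which is closed under $\neg,\vee,\wedge,\rightarrow,\leftrightarrow$. Fix a Gödel numbering of sentences of $\mathcal L$; $\#A$ denotes the Gödel number of $A$, $\lceil A\rceil$ the numeral of $\#A$, and $D$ the set of Gödel numbers of sentences of $\mathcal L$. For $U\subseteq D$, the sets $G(U),F(U)\subseteq D$ are determined (by induction on complexity of sentences) by the rules: (r1) for a sentence $A$ of $L$, $\#A\in G(U)$ iff $A$ is true in the interpretation of $L$, and $\#A\in F(U)$ iff $A$ is false in it; (r2) for a numeral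 $\mathbf n$, $\#T(\mathbf n)\in G(U)$ iff $\mathbf n=\lceil A\rceil$ for a sentence $A$ of $\mathcal L$ with $\#A\in U$, and $\#T(\mathbf n)\in F(U)$ iff $\mathbf n=\lceil A\rceil$ for a sentence $A$ of $\mathcal L$ with $\#[\neg A]\in U$; (r3) $\#[\neg A]\in G(U)$ iff $\#A\in F(U)$, and $\#[\neg A]\in F(U)$ iff $\#A\in G(U)$; (r4) $\#[A\vee B]\in G(U)$ iff $\#A\in G(U)$ or $\#B\in G(U)$, and $\in F(U)$ iff both $\#A,\#B\in F(U)$; (r5) $\#[A\wedge B]\in G(U)$ iff both $\#A,\#B\in G(U)$, and $\in F(U)$ iff $\#A\in F(U)$ or $\#B\in F(U)$; (r6) $\#[A\rightarrow B]\in G(U)$ iff $\#A\in F(U)$ or $\#B\in G(U)$, and $\in F(U)$ iff $\#A\in G(U)$ and $\#B\in F(U)$; (r7) $\#[A\leftrightarrow B]\in G(U)$ iff $\#A,\#B$ are both in $G(U)$ or both in $F(U)$, and $\in F(U)$ iff one of $\#A,\#B$ is in $G(U)$ and the other in $F(U)$; (r8) $\#[\exists xT(x)]\in G(U)$ iff $\#T(\mathbf n)\in G(U)$ for some numeral $\mathbf n$, and $\in F(U)$ iff $\#T(\mathbf n)\in F(U)$ for every numeral $\mathbf n$; (r9) $\#[\forall xT(x)]\in G(U)$ iff $\#T(\mathbf n)\in G(U)$ for every numeral $\mathbf n$, and $\in F(U)$ iff $\#T(\mathbf n)\in F(U)$ for some numeral $\mathbf n$. A set $U\subseteq D$ is consistent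 if there is no sentence $A$ of $\mathcal L$ with both $\#A\in U$ and $\#[\neg A]\in U$. For consistent $U$ with $U=G(U)$, $\mathcal L_U$ is the language of sentences $A$ of $\mathcal L$ with $\#A\in G(U)\cup F(U)$; such $A$ is called true iff $\#A\in G(U)$ and false iff $\#A\in F(U)$. -}

module Defs where

open import Data.Nat using (ℕ)
open import Data.Bool using (Bool; true; false)
open import Data.Product using (Σ; _×_; ∃)
open import Data.Sum using (_⊎_)
open import Data.Empty using (⊥)
open import Relation.Binary.PropositionalEquality using (_≡_)
open import Function.Definitions using (Injective)
open import Relation.Nullary using (¬_)

-- A mathematically agreeable language L, seen through the only data the
-- construction of 𝓛, G, F uses: its (countable) set of sentences and its
-- full classical interpretation (each sentence true or false, not both).
record MALang : Set₁ where
  field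
    Sentence : Set
    interp   : Sentence → Bool

-- The sentences of 𝓛, built over the sentences of L (parameter S).
-- Numerals are identified with the natural numbers they name.
data Sent𝓛 (S : Set) : Set where
  base  : S → Sent𝓛 S
  T     : ℕ → Sent𝓛 S
  ∀T    : Sent𝓛 S
  ∃T    : Sent𝓛 S
  ¬'_   : Sent𝓛 S → Sent𝓛 S
  _∨'_  : Sent𝓛 S → Sent𝓛 S → Sent𝓛 S
  _∧'_  : Sent𝓛 S → Sent𝓛 S → Sent𝓛 S
  _⇒'_  : Sent𝓛 S → Sent𝓛 S → Sent𝓛 S
  _⇔'_  : Sent𝓛 S → Sent𝓛 S → Sent𝓛 S

record GoedelNumbering (S : Set) : Set where
  field
    ♯     : Sent𝓛 S → ℕ
    ♯-inj : Injective _≡_ _≡_ ♯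

module Construction (L : MALang) (gn : GoedelNumbering (MALang.Sentence L)) where
  open MALang L
  open GoedelNumbering gn

  𝓢 : Set
  𝓢 = Sent𝓛 Sentence

  D : ℕ → Set
  D n = Σ 𝓢 λ A → ♯ A ≡ n

  -- rules (r1)-(r9), by recursion on the sentence: GS U A means #A ∈ G(U),
  -- FS U A means #A ∈ F(U).
  mutual
    GS : (ℕ → Set) → 𝓢 → Set
    GS U (base s) = interp s ≡ true
    GS U (T n)    = Σ 𝓢 λ A → (♯ A ≡ n) × U (♯ A)
    GS U ∀T       = (n : ℕ) → GS U (T n)
    GS U ∃T       = Σ ℕ λ n → GS U (T n)
    GS U (¬' A)   = FS U A
    GS U (A ∨' B) = GS U A ⊎ GS U B
    GS U (A ∧' B) = GS U A × GS U B
    GS U (A ⇒' B) = FS U A ⊎ GS U B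
    GS U (A ⇔' B) = (GS U A × GS U B) ⊎ (FS U A × FS U B)

    FS : (ℕ → Set) → 𝓢 → Set
    FS U (base s) = interp s ≡ false
    FS U (T n)    = Σ 𝓢 λ A → (♯ A ≡ n) × U (♯ (¬' A))
    FS U ∀T       = Σ ℕ λ n → FS U (T n)
    FS U ∃T       = (n : ℕ) → FS U (T n)
    FS U (¬' A)   = GS U A
    FS U (A ∨' B) = FS U A × FS U B
    FS U (A ∧' B) = FS U A ⊎ FS U B
    FS U (A ⇒' B) = GS U A × FS U B
    FS U (A ⇔' B) = (GS U A × FS U B) ⊎ (FS U A × GS U B)

  G : (ℕ → Set) → ℕ → Set
  G U n = Σ 𝓢 λ A → (♯ A ≡ n) × GS U A

  F : (ℕ → Set) → ℕ → Set
  F U n = Σ 𝓢 λ A → (♯ A ≡ n) × FS U A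

  _⊆D : (ℕ → Set) → Set
  U ⊆D = ∀ n → U n → D n

  Consistent : (ℕ → Set) → Set
  Consistent U = ¬ (Σ 𝓢 λ A → U (♯ A) × U (♯ (¬' A)))

  FixedPoint : (ℕ → Set) → Set
  FixedPoint U = ∀ n → (U n → G U n) × (G U n → U n)

-- Since U = G(U), a sentence A is true exactly when #A ∈ U, i.e. when T(⌜A⌝)
-- is true, and false exactly when #¬A ∈ U, i.e. when T(⌜A⌝) is false.  So A
-- and T(⌜A⌝) always share their truth value, which makes A ↔ T(⌜A⌝) true and
-- A ↔ ¬T(⌜A⌝) false.  Only the inclusion G(U) ⊆ U is needed.
module Submission where

open import Defs
open import Data.Nat using (ℕ)
open import Data.Product using (_×_; _,_; proj₂)
open import Data.Sum using (_⊎_; inj₁; inj₂)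
import Data.Sum as Sum
open import Relation.Binary.PropositionalEquality using (refl)

module TruthTransparency (L : MALang) (gn : GoedelNumbering (MALang.Sentence L)) where
  open Construction L gn
  open GoedelNumbering gn

  G⇒GS : ∀ {U A} → G U (♯ A) → GS U A
  G⇒GS (B , ♯B≡♯A , g) with ♯-inj ♯B≡♯A
  ... | refl = g

  F⇒FS : ∀ {U A} → F U (♯ A) → FS U A
  F⇒FS (B , ♯B≡♯A , f) with ♯-inj ♯B≡♯A
  ... | refl = f

  module _ {U : ℕ → Set} (G⊆U : ∀ n → G U n → U n) where

    GS⇒GS-T : ∀ {A} → GS U A → GS U (T (♯ A))
    GS⇒GS-T {A} g = A , refl , G⊆U (♯ A) (A , refl , g)

    FS⇒FS-T : ∀ {A} → FS U A → FS U (T (♯ A))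
    FS⇒FS-T {A} f = A , refl , G⊆U (♯ (¬' A)) (¬' A , refl , f)

    GS-⇔-T : ∀ {A} → GS U A ⊎ FS U A → GS U (A ⇔' T (♯ A))
    GS-⇔-T (inj₁ g) = inj₁ (g , GS⇒GS-T g)
    GS-⇔-T (inj₂ f) = inj₂ (f , FS⇒FS-T f)

lemma4p1 : (L : MALang) (gn : GoedelNumbering (MALang.Sentence L)) →
    let open Construction L gn
        open GoedelNumbering gn
    in (U : ℕ → Set) → U ⊆D → Consistent U → FixedPoint U →
    (A : 𝓢) → G U (♯ A) ⊎ F U (♯ A) →
    G U (♯ (A ⇔' T (♯ A))) × F U (♯ (A ⇔' (¬' T (♯ A))))
-- FS U (A ⇔' ¬' T n) unfolds to the very same type as GS U (A ⇔' T n).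
lemma4p1 L gn U _ _ fixed A valued =
  (_ , refl , A⇔TA) , (_ , refl , A⇔TA)
  where
  open Construction L gn
  open GoedelNumbering gn
  open TruthTransparency L gn

  A⇔TA : GS U (A ⇔' T (♯ A))
  A⇔TA = GS-⇔-T (λ n → proj₂ (fixed n)) (Sum.map G⇒GS F⇒FS valued)
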